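{- Let $n$ be an odd integer with $n>2$ and let $S$ be a finite set of primes each congruent to $1 \pmod{4n}$. Then the $(S\cup\{2\})$-unit equation $2X+Y+Z$ has no proper points.
   Context: Let $T$ be a finite set of primes. A proper point of the $T$-unit equation $2X+Y+Z$ is a point $[x:y:z]\in\mathbb{P}^2(\mathbb{Q})$ with integer representative $(x,y,z)$, $\gcd(x,y,z)=1$, such that $2x+y+z=0$, $xyz\neq 0$, the set of primes dividing $xyz$ is exactly $T$, and $2x,y,z$ are pairwise coprime. -}

module Defs where

open import Data.Nat as ℕ using (ℕ; _≡ᵇ_)
open import Data.Nat.Divisibility using (_∣_)
open import Data.Nat.GCD using (gcd)
open import Data.Nat.Coprimality using (Coprime)
open import Data.Nat.Primality using (Prime)
open import Data.Integer as ℤ using (ℤ; ∣_∣; +_)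
open import Data.List using (List)
open import Data.List.Membership.Propositional using (_∈_)
open import Data.Product using (_×_)
open import Relation.Binary.PropositionalEquality using (_≡_; _≢_)
open import Relation.Nullary using (¬_)
open import Function.Bundles using (_⇔_)

-- A finite set of primes T is represented by a list of naturals (members of T).
-- (x , y , z) is a proper point of the T-unit equation 2X+Y+Z, given by a
-- primitive integer representative of [x:y:z] ∈ ℙ²(ℚ).
record ProperPoint (T : List ℕ) (x y z : ℤ) : Set where
  field
    gcdOne       : gcd (gcd ∣ x ∣ ∣ y ∣) ∣ z ∣ ≡ 1
    onLine       : (+ 2) ℤ.* x ℤ.+ y ℤ.+ z ≡ + 0
    nonzero      : x ℤ.* y ℤ.* z ≢ + 0
    primesExact  : ∀ (p : ℕ) → Prime p → (p ∣ ∣ x ℤ.* y ℤ.* z ∣ ⇔ p ∈ T)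
    coprime2xy   : Coprime ∣ (+ 2) ℤ.* x ∣ ∣ y ∣
    coprime2xz   : Coprime ∣ (+ 2) ℤ.* x ∣ ∣ z ∣
    coprimeyz    : Coprime ∣ y ∣ ∣ z ∣

module Submission where

-- Since 2x is coprime to y and z, both y and z are odd, so all
-- their prime factors lie in S and hence |y| ≡ |z| ≡ 1 (mod 4n).  As 2
-- divides xyz but not yz, x is even and 4 ∣ 2|x| = |y + z|.  Now either
-- |y + z| = |y| + |z| ≡ 2 (mod 4), which is impossible, or
-- |y + z| = | |y| - |z| | ≡ 0 (mod 4n); then n ∣ x, and a prime q ∣ n is
-- odd, divides xyz and so lies in S, whence q > 4n ≥ n, contradicting q ∣ n.

open import Defs
open import Data.Nat using (ℕ; _*_; _+_; _<_)
open import Data.Nat.Divisibility using (_∣_)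
open import Data.Nat.Primality using (Prime)
open import Data.Integer using (ℤ)
open import Data.List using (List; _∷_)
open import Data.List.Membership.Propositional using (_∈_)
open import Data.List.Relation.Unary.All using (All)
open import Data.Product using (∃)
open import Relation.Binary.PropositionalEquality using (_≡_)
open import Relation.Nullary using (¬_)

open import Data.Nat as ℕ using (suc; zero; ∣_-_∣; NonZero; z<s; s<s)
import Data.Nat.Properties as ℕ
open import Data.Nat.Divisibility
  using (divides; _∣0; ∣-trans; ∣⇒≤; m∣m*n; ∣m⇒∣m*n; ∣n⇒∣m*n; ∣m+n∣m⇒∣n; m*n∣⇒n∣; *-monoʳ-∣; *-cancelˡ-∣)
open import Data.Nat.Primality using (euclidsLemma; ¬prime[1]; prime[2])
open import Data.Nat.Primality.Factorisation using (factorise; PrimeFactorisation)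
open import Data.Nat.ListAction using (product)
open import Data.Nat.ListAction.Properties using (∈⇒∣product)
open import Data.Nat.Tactic.RingSolver using (solve-∀)
open import Data.Integer as ℤ using (+_; -[1+_]; _⊖_)
import Data.Integer.Properties as ℤ
open import Algebra.Properties.AbelianGroup ℤ.+-0-abelianGroup using (inverseʳ-unique)
open import Data.List using ([])
import Data.List.Relation.Unary.All as All
open import Data.List.Relation.Unary.Any using (here; there)
open import Data.Product using (_,_; _×_)
open import Data.Sum using (_⊎_; inj₁; inj₂)
open import Data.Empty using (⊥-elim)
open import Function.Base using (_∘_)
open import Function.Bundles using (Equivalence)
open import Relation.Binary.PropositionalEquality using (_≢_; refl; sym; trans; cong; subst; subst₂; module ≡-Reasoning)

OneMod : ℕ → ℕ → Set
OneMod M m = ∃ λ k → m ≡ 1 + k * M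

oneMod-* : ∀ {M m m′} → OneMod M m → OneMod M m′ → OneMod M (m * m′)
oneMod-* {M} (a , refl) (b , refl) = a + b + a * b * M , expand a b M
  where
  expand : ∀ a b M → (1 + a * M) * (1 + b * M) ≡ 1 + (a + b + a * b * M) * M
  expand = solve-∀

oneMod-product : ∀ {M ms} → All (OneMod M) ms → OneMod M (product ms)
oneMod-product All.[]           = 0 , refl
oneMod-product (m≡1 All.∷ ms≡1) = oneMod-* m≡1 (oneMod-product ms≡1)

-- A positive number all of whose prime factors are ≡ 1 (mod M) is itself
-- ≡ 1 (mod M): it is the product of its prime factorisation.
oneMod-byPrimeFactors : ∀ {M} m → .{{_ : NonZero m}} →
  (∀ {p} → Prime p → p ∣ m → OneMod M p) → OneMod M m
oneMod-byPrimeFactors {M} m factorsOneMod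
  with record { factors = ps ; isFactorisation = m≡∏ps ; factorsPrime = psPrime } ← factorise m
  = subst (OneMod M) (sym m≡∏ps) (oneMod-product (All.tabulate factorOneMod))
  where
  factorOneMod : ∀ {p} → p ∈ ps → OneMod M p
  factorOneMod p∈ps =
    factorsOneMod (All.lookup psPrime p∈ps) (subst (_ ∣_) (sym m≡∏ps) (∈⇒∣product p∈ps))

oneMod-large : ∀ {M q} → OneMod M q → q ≢ 1 → M < q
oneMod-large (zero  , refl) q≢1 = ⊥-elim (q≢1 refl)
oneMod-large {M} (suc k , refl) _ = s<s (ℕ.m≤m+n M (k * M))

-- Sums of two numbers ≡ 1 (mod M) are ≡ 2 (mod M): a divisor of M that
-- divides such a sum divides 2.
oneMod-sum : ∀ {d M a b} → d ∣ M → OneMod M a → OneMod M b → d ∣ a + b → d ∣ 2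
oneMod-sum {d} {M} d∣M (k , refl) (l , refl) d∣a+b =
  ∣m+n∣m⇒∣n (subst (d ∣_) (regroup k l M) d∣a+b) (∣n⇒∣m*n (k + l) d∣M)
  where
  regroup : ∀ k l M → (1 + k * M) + (1 + l * M) ≡ (k + l) * M + 2
  regroup = solve-∀

oneMod-distance : ∀ {M a b} → OneMod M a → OneMod M b → M ∣ ∣ a - b ∣
oneMod-distance {M} (k , refl) (l , refl) = divides ∣ k - l ∣ (sym (ℕ.*-distribʳ-∣-∣ M k l))

∣⊖∣≡∣-∣ : ∀ m n → ℤ.∣ m ⊖ n ∣ ≡ ∣ m - n ∣
∣⊖∣≡∣-∣ zero    zero    = refl
∣⊖∣≡∣-∣ zero    (suc n) = refl
∣⊖∣≡∣-∣ (suc m) zero    = refl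
∣⊖∣≡∣-∣ (suc m) (suc n) = trans (cong ℤ.∣_∣ (ℤ.[1+m]⊖[1+n]≡m⊖n m n)) (∣⊖∣≡∣-∣ m n)

∣+∣-signs : ∀ i j → ℤ.∣ i ℤ.+ j ∣ ≡ ℤ.∣ i ∣ + ℤ.∣ j ∣ ⊎ ℤ.∣ i ℤ.+ j ∣ ≡ ∣ ℤ.∣ i ∣ - ℤ.∣ j ∣ ∣
∣+∣-signs (+ m)     (+ n)     = inj₁ refl
∣+∣-signs (+ m)     -[1+ n ]  = inj₂ (∣⊖∣≡∣-∣ m (suc n))
∣+∣-signs -[1+ m ]  (+ n)     = inj₂ (trans (∣⊖∣≡∣-∣ n (suc m)) (ℕ.∣-∣-comm n (suc m)))
∣+∣-signs -[1+ m ]  -[1+ n ]  = inj₁ (cong suc (sym (ℕ.+-suc m n)))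

-- If |i|, |j| ≡ 1 (mod M) with 4 ∣ M, then 4 ∣ |i + j| forces M ∣ |i + j|:
-- equal signs would give |i + j| ≡ 2 (mod 4).
oneMod-∣+∣ : ∀ {M} i j → 4 ∣ M → OneMod M ℤ.∣ i ∣ → OneMod M ℤ.∣ j ∣ →
  4 ∣ ℤ.∣ i ℤ.+ j ∣ → M ∣ ℤ.∣ i ℤ.+ j ∣
oneMod-∣+∣ i j 4∣M i≡1 j≡1 4∣i+j with ∣+∣-signs i j
... | inj₁ sum  = ⊥-elim (4∤2 (oneMod-sum 4∣M i≡1 j≡1 (subst (4 ∣_) sum 4∣i+j)))
  where
  4∤2 : ¬ (4 ∣ 2)
  4∤2 4∣2 = ℕ.<⇒≱ (s<s (s<s z<s)) (∣⇒≤ 4∣2)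
... | inj₂ dist = subst (_ ∣_) (sym dist) (oneMod-distance i≡1 j≡1)

odd⇒nonZero : ∀ {m} → ¬ (2 ∣ m) → NonZero m
odd⇒nonZero {zero}  odd = ⊥-elim (odd (2 ∣0))
odd⇒nonZero {suc m} _   = _

primeDivisor : ∀ n → 1 < n → ∃ λ q → Prime q × q ∣ n
primeDivisor n 1<n = fromFactors (factorise n {{ℕ.>-nonZero (ℕ.<-trans z<s 1<n)}})
  where
  fromFactors : PrimeFactorisation n → ∃ λ q → Prime q × q ∣ n
  fromFactors record { factors = [] ; isFactorisation = n≡1 } =
    ⊥-elim (ℕ.<⇒≢ 1<n (sym n≡1))
  fromFactors record { factors = q ∷ qs ; isFactorisation = n≡q*∏qs ; factorsPrime = qPrime All.∷ _ } =
    q , qPrime , subst (q ∣_) (sym n≡q*∏qs) (∈⇒∣product {ns = q ∷ qs} (here refl))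

module ProperPointFacts {T : List ℕ} {x y z : ℤ} (pp : ProperPoint T x y z) where
  open ProperPoint pp

  ∣xyz∣ : ℕ
  ∣xyz∣ = ℤ.∣ x ∣ * ℤ.∣ y ∣ * ℤ.∣ z ∣

  ∣x*y*z∣≡∣xyz∣ : ℤ.∣ x ℤ.* y ℤ.* z ∣ ≡ ∣xyz∣
  ∣x*y*z∣≡∣xyz∣ = trans (ℤ.abs-* (x ℤ.* y) z) (cong (_* ℤ.∣ z ∣) (ℤ.abs-* x y))

  divisor⇒∈T : ∀ {p} → Prime p → p ∣ ∣xyz∣ → p ∈ T
  divisor⇒∈T p-prime p∣xyz =
    Equivalence.to (primesExact _ p-prime) (subst (_ ∣_) (sym ∣x*y*z∣≡∣xyz∣) p∣xyz)

  ∈T⇒divisor : ∀ {p} → Prime p → p ∈ T → p ∣ ∣xyz∣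
  ∈T⇒divisor p-prime p∈T =
    subst (_ ∣_) ∣x*y*z∣≡∣xyz∣ (Equivalence.from (primesExact _ p-prime) p∈T)

  ∣2x∣≡2∣x∣ : ℤ.∣ + 2 ℤ.* x ∣ ≡ 2 * ℤ.∣ x ∣
  ∣2x∣≡2∣x∣ = ℤ.abs-* (+ 2) x

  2∣∣2x∣ : 2 ∣ ℤ.∣ + 2 ℤ.* x ∣
  2∣∣2x∣ = subst (2 ∣_) (sym ∣2x∣≡2∣x∣) (m∣m*n ℤ.∣ x ∣)

  y-odd : ¬ (2 ∣ ℤ.∣ y ∣)
  y-odd 2∣y with () ← coprime2xy (2∣∣2x∣ , 2∣y)

  z-odd : ¬ (2 ∣ ℤ.∣ z ∣)
  z-odd 2∣z with () ← coprime2xz (2∣∣2x∣ , 2∣z)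

  y-divisor : ∀ {p} → Prime p → p ∣ ℤ.∣ y ∣ → p ∈ T × p ≢ 2
  y-divisor p-prime p∣y =
    divisor⇒∈T p-prime (∣m⇒∣m*n ℤ.∣ z ∣ (∣n⇒∣m*n ℤ.∣ x ∣ p∣y)) , λ { refl → y-odd p∣y }

  z-divisor : ∀ {p} → Prime p → p ∣ ℤ.∣ z ∣ → p ∈ T × p ≢ 2
  z-divisor p-prime p∣z =
    divisor⇒∈T p-prime (∣n⇒∣m*n (ℤ.∣ x ∣ * ℤ.∣ y ∣) p∣z) , λ { refl → z-odd p∣z }

  x-even : 2 ∈ T → 2 ∣ ℤ.∣ x ∣
  x-even 2∈T with euclidsLemma (ℤ.∣ x ∣ * ℤ.∣ y ∣) ℤ.∣ z ∣ prime[2] (∈T⇒divisor prime[2] 2∈T)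
  ... | inj₂ 2∣z = ⊥-elim (z-odd 2∣z)
  ... | inj₁ 2∣xy with euclidsLemma ℤ.∣ x ∣ ℤ.∣ y ∣ prime[2] 2∣xy
  ...   | inj₁ 2∣x = 2∣x
  ...   | inj₂ 2∣y = ⊥-elim (y-odd 2∣y)

  ∣y+z∣≡2∣x∣ : ℤ.∣ y ℤ.+ z ∣ ≡ 2 * ℤ.∣ x ∣
  ∣y+z∣≡2∣x∣ = begin
    ℤ.∣ y ℤ.+ z ∣              ≡⟨ cong ℤ.∣_∣ y+z≡-2x ⟩
    ℤ.∣ ℤ.- (+ 2 ℤ.* x) ∣      ≡⟨ ℤ.∣-i∣≡∣i∣ (+ 2 ℤ.* x) ⟩
    ℤ.∣ + 2 ℤ.* x ∣            ≡⟨ ∣2x∣≡2∣x∣ ⟩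
    2 * ℤ.∣ x ∣                ∎
    where
    open ≡-Reasoning
    y+z≡-2x : y ℤ.+ z ≡ ℤ.- (+ 2 ℤ.* x)
    y+z≡-2x = inverseʳ-unique (+ 2 ℤ.* x) (y ℤ.+ z)
      (trans (sym (ℤ.+-assoc (+ 2 ℤ.* x) y z)) onLine)

lemma1p10 : (n : ℕ) → ¬ (2 ∣ n) → 2 < n →
    (S : List ℕ) →
    All (λ p → Prime p) S →
    All (λ p → ∃ λ k → p ≡ 1 + k * (4 * n)) S →
    ∀ (x y z : ℤ) → ¬ ProperPoint (2 ∷ S) x y z
-- A prime divisor q of n satisfies n ≤ 4n < q (as q ≡ 1 (mod 4n)) and
-- q ≤ n (as q ∣ n), a contradiction.
lemma1p10 n n-odd 2<n S _ S≡1 x y z pp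
  with q , q-prime , q∣n ← primeDivisor n (ℕ.<-trans (s<s z<s) 2<n)
  = ℕ.<⇒≱ (ℕ.≤-<-trans (ℕ.m≤n*m n 4) (oneMod-large q≡1 q≢1)) (∣⇒≤ {{odd⇒nonZero n-odd}} q∣n)
  where
  open ProperPointFacts pp

  oddMember≡1 : ∀ {p} → p ∈ 2 ∷ S × p ≢ 2 → OneMod (4 * n) p
  oddMember≡1 (here p≡2 , p≢2) = ⊥-elim (p≢2 p≡2)
  oddMember≡1 (there p∈S , _)  = All.lookup S≡1 p∈S

  y≡1 : OneMod (4 * n) ℤ.∣ y ∣
  y≡1 = oneMod-byPrimeFactors _ {{odd⇒nonZero y-odd}} (λ p-prime → oddMember≡1 ∘ y-divisor p-prime)

  z≡1 : OneMod (4 * n) ℤ.∣ z ∣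
  z≡1 = oneMod-byPrimeFactors _ {{odd⇒nonZero z-odd}} (λ p-prime → oddMember≡1 ∘ z-divisor p-prime)

  -- x is even, so 4 ∣ 2|x| = |y + z|; hence 4n ∣ 2|x| and n ∣ |x|.
  n∣x : n ∣ ℤ.∣ x ∣
  n∣x = m*n∣⇒n∣ 2 n (*-cancelˡ-∣ 2 (subst₂ _∣_ (ℕ.*-assoc 2 2 n) ∣y+z∣≡2∣x∣ 4n∣y+z))
    where
    4n∣y+z : 4 * n ∣ ℤ.∣ y ℤ.+ z ∣
    4n∣y+z = oneMod-∣+∣ y z (m∣m*n n) y≡1 z≡1
      (subst (4 ∣_) (sym ∣y+z∣≡2∣x∣) (*-monoʳ-∣ 2 (x-even (here refl))))

  q≡1 : OneMod (4 * n) q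
  q≡1 = oddMember≡1
    (divisor⇒∈T q-prime (∣m⇒∣m*n ℤ.∣ z ∣ (∣m⇒∣m*n ℤ.∣ y ∣ (∣-trans q∣n n∣x))) , λ { refl → n-odd q∣n })

  q≢1 : q ≢ 1
  q≢1 refl = ¬prime[1] q-prime
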